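{- Let $k\ge 0$ and $l\ge 0$ be integers. If a graph $G$ contains $k$ spanning rigid subgraphs and $l$ spanning trees, all pairwise edge-disjoint, then for every partition $\pi$ of $V(G)$ with $n_0$ trivial parts, $e_G(\pi)\ge (3k+l)(|\pi|-1)-kn_0$.
   Context: Graphs may have multiple edges but no loops. For a partition $\pi$ of $V(G)$, $e_G(\pi)$ is the number of edges whose ends lie in different parts of $\pi$, and a part is trivial if it consists of a single vertex. For $X\subseteq V(H)$, $i_H(X)$ is the number of edges of $H[X]$; $H$ is sparse if $i_H(X)\le 2|X|-3$ for all $X$ with $|X|\ge 2$, minimally rigid if additionally $|E(H)|=2|V(H)|-3$, and rigid if it contains a spanning minimally rigid subgraph. -}

module Defs where

open import Data.Nat using (ℕ; zero; suc; _+_; _*_; _≤_)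
open import Data.Nat.Properties using () renaming (_≟_ to _≟ℕ_)
open import Data.Fin using (Fin; _≟_)
open import Data.Fin.Subset using (Subset; _∈_; _⊆_; ∣_∣; _∩_; Empty)
open import Data.Bool using (Bool; true; false; _∧_; not)
open import Data.Vec using (tabulate; lookup)
open import Data.Product using (Σ; _×_; _,_; proj₁; proj₂)
open import Relation.Binary.PropositionalEquality using (_≡_; _≢_)
open import Relation.Nullary using (¬_)
open import Relation.Nullary.Decidable using (⌊_⌋)

-- Parallel edges are allowed (distinct labels may have equal ends).
record Graph (n m : ℕ) : Set where
  field
    ends     : Fin m → Fin n × Fin n
    loopless : ∀ e → proj₁ (ends e) ≢ proj₂ (ends e)
open Graph public

module _ {n m : ℕ} (G : Graph n m) where

  tail head : Fin m → Fin n
  tail e = proj₁ (ends G e)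
  head e = proj₂ (ends G e)

  -- A spanning subgraph of G is given by its edge set S ⊆ E(G).
  -- i_S(X): number of edges of S with both ends in X.
  inducedEdges : Subset m → Subset n → ℕ
  inducedEdges S X = ∣ tabulate (λ e → lookup S e ∧ (lookup X (tail e) ∧ lookup X (head e))) ∣

  -- Sparse: i_S(X) ≤ 2|X| - 3 whenever |X| ≥ 2 (written i + 3 ≤ 2|X|).
  Sparse : Subset m → Set
  Sparse S = ∀ (X : Subset n) → 2 ≤ ∣ X ∣ → inducedEdges S X + 3 ≤ 2 * ∣ X ∣

  MinimallyRigid : Subset m → Set
  MinimallyRigid S = Sparse S × (∣ S ∣ + 3 ≡ 2 * n)

  Rigid : Subset m → Set
  Rigid S = Σ (Subset m) λ T → T ⊆ S × MinimallyRigid T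

  data Reach (S : Subset m) : Fin n → Fin n → Set where
    here : ∀ {x} → Reach S x x
    fwd  : ∀ {x} e → e ∈ S → Reach S (head e) x → Reach S (tail e) x
    bwd  : ∀ {x} e → e ∈ S → Reach S (tail e) x → Reach S (head e) x

  Connected : Subset m → Set
  Connected S = ∀ x y → Reach S x y

  SpanningTree : Subset m → Set
  SpanningTree S = Connected S × (∀ e → e ∈ S → ¬ Connected (tabulate (λ f → lookup S f ∧ not ⌊ f ≟ e ⌋)))

-- A partition π of Fin n into r parts: a surjection p : Fin n → Fin r,
-- the parts being the fibres p⁻¹(j). So |π| = r.
Surjective : ∀ {n r} → (Fin n → Fin r) → Set
Surjective {n} p = ∀ j → Σ (Fin n) λ v → p v ≡ j

partSize : ∀ {n r} → (Fin n → Fin r) → Fin r → ℕ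
partSize p j = ∣ tabulate (λ v → ⌊ p v ≟ j ⌋) ∣

trivialParts : ∀ {n r} → (Fin n → Fin r) → ℕ
trivialParts {r = r} p = ∣ tabulate (λ j → ⌊ partSize p j ≟ℕ 1 ⌋) ∣

crossEdges : ∀ {n m r} → Graph n m → (Fin n → Fin r) → ℕ
crossEdges G p = ∣ tabulate (λ e → not ⌊ p (tail G e) ≟ p (head G e) ⌋) ∣

module Submission where

-- Write e_S(π) for the number of edges of
-- S crossing π.  The proof combines three counting bounds:
--   (1) a connected spanning subgraph S has e_S(π) ≥ r - 1: merging two
--       parts joined by an edge of S removes a crossing edge (induction on r);
--   (2) a rigid spanning subgraph S has e_S(π) ≥ 3r - 3 - n₀: inside a
--       minimally rigid M ⊆ S, a part X spans at most 2|X| - 3 edges, or none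
--       if |X| = 1; summing over the parts and using |M| = 2|V| - 3 gives it;
--   (3) by edge-disjointness, Σᵢ e_{Rᵢ}(π) + Σⱼ e_{Tⱼ}(π) ≤ e_G(π).
-- Summing (2) over the Rᵢ and (1) over the Tⱼ and applying (3) gives
-- (3k+l) r ≤ e_G(π) + k n₀ + (3k+l) in ℕ, which is the claimed bound in ℤ.

open import Defs
open import Data.Nat using (ℕ)
open import Data.Fin using (Fin)
open import Data.Fin.Subset using (Subset; _∩_; Empty)
open import Data.Integer using (ℤ; +_; _-_; _*_; _≤_)
open import Relation.Binary.PropositionalEquality using (_≢_)

import Data.Nat as ℕ
open import Data.Nat using (zero; suc; _+_; z≤n; s≤s)
open import Data.Nat.Properties as ℕP
  using (≤-refl; ≤-reflexive; ≤-trans; +-mono-≤; +-monoˡ-≤; m≤m+n; m≤n+m)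
open import Data.Nat.Solver using (module +-*-Solver)
import Data.Integer as ℤ
import Data.Integer.Properties as ℤP
import Data.Integer.Solver as ℤSolver
open import Data.Fin using (zero; suc; _≟_)
open import Data.Fin.Properties using (suc-injective; any?; 0≢1+n)
open import Data.Fin.Subset using (∣_∣; _∈_; _⊆_)
open import Data.Fin.Subset.Properties using (x∈p∩q⁺)
open import Data.Bool using (Bool; true; false; _∧_; not)
open import Data.Bool.Properties as BoolP using (∧-assoc; ∧-comm; ∧-identityʳ; ∧-zeroʳ; T-≡)
open import Data.Vec using (tabulate; lookup)
open import Data.Vec.Properties using (lookup∘tabulate; tabulate∘lookup; []=⇒lookup; lookup⇒[]=)
open import Data.Product using (Σ-syntax; _×_; _,_; proj₁; proj₂)
open import Data.Sum using (_⊎_; inj₁; inj₂)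
open import Data.Empty using (⊥; ⊥-elim)
open import Function using (_∘_; Equivalence)
open import Relation.Binary.PropositionalEquality
  using (_≡_; refl; sym; trans; cong; cong₂; subst; module ≡-Reasoning)
open import Relation.Nullary using (yes; no)
open import Relation.Nullary.Decidable using (⌊_⌋; dec-true; dec-false; isYes≗does; ⌊⌋-map′; toWitness)
open import Algebra.Properties.Semiring.Sum ℕP.+-*-semiring
  using (sum; sum-syntax; sum-cong-≗; sum-replicate-zero; ∑-distrib-+; ∑-comm; *-distribˡ-sum)

-- Counting: a boolean predicate on Fin m is counted as a sum of 0/1 values.

⟦_⟧ : Bool → ℕ
⟦ true ⟧ = 1
⟦ false ⟧ = 0

count : ∀ {m} → (Fin m → Bool) → ℕ
count {m} f = ∑[ i < m ] ⟦ f i ⟧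

_⊆ᵇ_ : ∀ {m} → (Fin m → Bool) → (Fin m → Bool) → Set
f ⊆ᵇ g = ∀ x → f x ≡ true → g x ≡ true

∧-true⁻ : ∀ {a b} → a ∧ b ≡ true → a ≡ true × b ≡ true
∧-true⁻ {true} {true} _ = refl , refl

⌊≟⌋-true : ∀ {r} {x y : Fin r} → x ≡ y → ⌊ x ≟ y ⌋ ≡ true
⌊≟⌋-true {x = x} {y} x≡y = trans (isYes≗does (x ≟ y)) (dec-true (x ≟ y) x≡y)

⌊≟⌋-false : ∀ {r} {x y : Fin r} → x ≢ y → ⌊ x ≟ y ⌋ ≡ false
⌊≟⌋-false {x = x} {y} x≢y = trans (isYes≗does (x ≟ y)) (dec-false (x ≟ y) x≢y)

⌊≟⌋-true⁻ : ∀ {r} {x y : Fin r} → ⌊ x ≟ y ⌋ ≡ true → x ≡ y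
⌊≟⌋-true⁻ h = toWitness (Equivalence.from T-≡ h)

-- Every cardinality in the definitions is that of a tabulated subset.
∣tabulate∣≡count : ∀ {m} (f : Fin m → Bool) → ∣ tabulate f ∣ ≡ count f
∣tabulate∣≡count {zero} f = refl
∣tabulate∣≡count {suc m} f with f zero
... | true = cong suc (∣tabulate∣≡count (f ∘ suc))
... | false = ∣tabulate∣≡count (f ∘ suc)

∣p∣≡count : ∀ {m} (X : Subset m) → ∣ X ∣ ≡ count (lookup X)
∣p∣≡count X = trans (cong ∣_∣ (sym (tabulate∘lookup X))) (∣tabulate∣≡count (lookup X))

sum-const : ∀ {r} (c : ℕ) → ∑[ i < r ] c ≡ r ℕ.* c
sum-const {zero} c = refl
sum-const {suc r} c = cong (_+_ c) (sum-const {r} c)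

sum-mono : ∀ {r} {f g : Fin r → ℕ} → (∀ i → f i ℕ.≤ g i) → sum f ℕ.≤ sum g
sum-mono {zero} _ = z≤n
sum-mono {suc r} f≤g = +-mono-≤ (f≤g zero) (sum-mono (f≤g ∘ suc))

sum-bound : ∀ {r} {a b : ℕ} (f : Fin r → ℕ) → (∀ i → a ℕ.≤ f i + b) → r ℕ.* a ℕ.≤ sum f + r ℕ.* b
sum-bound {r} {a} {b} f bound = begin
  r ℕ.* a                      ≡⟨ sum-const {r} a ⟨
  ∑[ i < r ] a                 ≤⟨ sum-mono bound ⟩
  ∑[ i < r ] (f i + b)         ≡⟨ ∑-distrib-+ f (λ _ → b) ⟩
  sum f + ∑[ i < r ] b         ≡⟨ cong (_+_ (sum f)) (sum-const {r} b) ⟩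
  sum f + r ℕ.* b              ∎
  where open ℕP.≤-Reasoning

-- Exactly one index j satisfies x = j.
sum-pick : ∀ {r} (x : Fin r) (P : Fin r → Bool) → sum (λ j → ⟦ ⌊ x ≟ j ⌋ ∧ P j ⟧) ≡ ⟦ P x ⟧
sum-pick {suc r} zero P = trans (cong (_+_ ⟦ P zero ⟧) (sum-replicate-zero r)) (ℕP.+-identityʳ _)
sum-pick {suc r} (suc x) P =
  trans (sum-cong-≗ (λ j → cong (λ d → ⟦ d ∧ P (suc j) ⟧) (⌊⌋-map′ _ _ (x ≟ j)))) (sum-pick x (P ∘ suc))

⟦⟧-mono : ∀ {a b} → (a ≡ true → b ≡ true) → ⟦ a ⟧ ℕ.≤ ⟦ b ⟧
⟦⟧-mono {false} _ = z≤n
⟦⟧-mono {true} a⇒b rewrite a⇒b refl = ≤-refl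

count-mono : ∀ {m} {f g : Fin m → Bool} → f ⊆ᵇ g → count f ℕ.≤ count g
count-mono f⊆g = sum-mono (λ x → ⟦⟧-mono (f⊆g x))

count-strict : ∀ {m} {f g : Fin m → Bool} → f ⊆ᵇ g → ∀ e → f e ≡ false → g e ≡ true →
  suc (count f) ℕ.≤ count g
count-strict f⊆g zero fe ge rewrite fe | ge = s≤s (count-mono (f⊆g ∘ suc))
count-strict {suc m} {f} {g} f⊆g (suc e) fe ge =
  subst (ℕ._≤ count g) (ℕP.+-suc ⟦ f zero ⟧ _)
    (+-mono-≤ (⟦⟧-mono (f⊆g zero)) (count-strict (f⊆g ∘ suc) e fe ge))

count-pos : ∀ {m} {f : Fin m → Bool} x → f x ≡ true → 1 ℕ.≤ count f
count-pos zero fx rewrite fx = s≤s z≤n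
count-pos {f = f} (suc x) fx = ≤-trans (count-pos x fx) (m≤n+m _ ⟦ f zero ⟧)

count-two : ∀ {m} {f : Fin m → Bool} a b → a ≢ b → f a ≡ true → f b ≡ true → 2 ℕ.≤ count f
count-two {m} {f} a b a≢b fa fb =
  ≤-trans (s≤s (count-pos a fa∖b)) (count-strict (λ x → proj₁ ∘ ∧-true⁻) b fb∖b fb)
  where
  f∖b : Fin m → Bool
  f∖b x = f x ∧ not ⌊ x ≟ b ⌋
  fa∖b : f∖b a ≡ true
  fa∖b = cong₂ (λ s d → s ∧ not d) fa (⌊≟⌋-false a≢b)
  fb∖b : f∖b b ≡ false
  fb∖b = trans (cong (λ d → f b ∧ not d) (⌊≟⌋-true refl)) (∧-zeroʳ (f b))

count-none : ∀ {m} {f : Fin m → Bool} → (∀ x → f x ≢ true) → count f ≡ 0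
count-none {zero} _ = refl
count-none {suc m} {f} none with f zero in f0
... | true = ⊥-elim (none zero f0)
... | false = count-none (none ∘ suc)

count-∧ : ∀ {t} (a : Fin t → Bool) c → count (λ i → a i ∧ c) ≡ ⟦ c ⟧ ℕ.* count a
count-∧ a true = trans (sum-cong-≗ (λ i → cong ⟦_⟧ (∧-identityʳ (a i)))) (sym (ℕP.*-identityˡ _))
count-∧ {t} a false = trans (sum-cong-≗ (λ i → cong ⟦_⟧ (∧-zeroʳ (a i)))) (sum-replicate-zero t)

Exclusive : ∀ {t} → (Fin t → Bool) → Set
Exclusive a = ∀ i i′ → i ≢ i′ → a i ≡ true → a i′ ≡ true → ⊥

exclusive-count≤1 : ∀ {t} {a : Fin t → Bool} → Exclusive a → count a ℕ.≤ 1
exclusive-count≤1 {zero} _ = z≤n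
exclusive-count≤1 {suc t} {a} excl with a zero in a0
... | true = s≤s (≤-reflexive (count-none (λ i → excl zero (suc i) (λ ()) a0)))
... | false = exclusive-count≤1 (λ i i′ i≢i′ → excl (suc i) (suc i′) (i≢i′ ∘ suc-injective))

exclusive-pair : ∀ {k l} {a : Fin k → Bool} {b : Fin l → Bool} → Exclusive a → Exclusive b →
  (∀ i j → a i ≡ true → b j ≡ true → ⊥) → count a + count b ℕ.≤ 1
exclusive-pair {a = a} {b} excla exclb apart with any? (λ i → a i BoolP.≟ true)
... | yes (i , ai) = subst (λ c → count a + c ℕ.≤ 1) (sym (count-none (λ j → apart i j ai)))
                       (subst (ℕ._≤ 1) (sym (ℕP.+-identityʳ _)) (exclusive-count≤1 excla))
... | no none = subst (λ c → c + count b ℕ.≤ 1) (sym (count-none (λ i ai → none (i , ai))))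
                  (exclusive-count≤1 exclb)

disjoint⇒exclusive : ∀ {t m} (F : Fin t → Subset m) → (∀ i i′ → i ≢ i′ → Empty (F i ∩ F i′)) →
  ∀ e → Exclusive (λ i → lookup (F i) e)
disjoint⇒exclusive F disj e i i′ i≢i′ h h′ =
  disj i i′ i≢i′ (e , x∈p∩q⁺ (lookup⇒[]= e (F i) h , lookup⇒[]= e (F i′) h′))

part : ∀ {n r} → (Fin n → Fin r) → Fin r → Subset n
part p j = tabulate (λ v → ⌊ p v ≟ j ⌋)

sum-partSize : ∀ {n r} (p : Fin n → Fin r) → ∑[ j < r ] partSize p j ≡ n
sum-partSize {n} {r} p = begin
  ∑[ j < r ] partSize p j                            ≡⟨ sum-cong-≗ {r} (λ j → ∣tabulate∣≡count {n} _) ⟩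
  ∑[ j < r ] ∑[ v < n ] ⟦ ⌊ p v ≟ j ⌋ ⟧              ≡⟨ ∑-comm (λ j v → ⟦ ⌊ p v ≟ j ⌋ ⟧) ⟩
  ∑[ v < n ] ∑[ j < r ] ⟦ ⌊ p v ≟ j ⌋ ⟧              ≡⟨ sum-cong-≗ one-part ⟩
  ∑[ v < n ] 1                                       ≡⟨ sum-const {n} 1 ⟩
  n ℕ.* 1                                            ≡⟨ ℕP.*-identityʳ n ⟩
  n                                                  ∎
  where
  open ≡-Reasoning
  one-part : ∀ v → ∑[ j < r ] ⟦ ⌊ p v ≟ j ⌋ ⟧ ≡ 1
  one-part v = trans (sum-cong-≗ {r} (λ j → cong ⟦_⟧ (sym (∧-identityʳ _)))) (sum-pick (p v) (λ _ → true))

partSize-pos : ∀ {n r} (p : Fin n → Fin r) → Surjective p → ∀ j → 1 ℕ.≤ partSize p j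
partSize-pos {n} p surj j = subst (1 ℕ.≤_) (sym (∣tabulate∣≡count {n} _))
  (count-pos (proj₁ (surj j)) (⌊≟⌋-true (proj₂ (surj j))))

merge : ∀ {r} → Fin r → Fin (suc r) → Fin r
merge v zero = v
merge v (suc j) = j

merge-surjective : ∀ {n r} (v : Fin r) (q : Fin n → Fin (suc r)) → Surjective q → Surjective (merge v ∘ q)
merge-surjective v q surj j = proj₁ (surj (suc j)) , cong (merge v) (proj₂ (surj (suc j)))

merge-joins : ∀ {r} (a b : Fin (suc r)) → (a ≡ zero × b ≢ zero) ⊎ (b ≡ zero × a ≢ zero) →
  Σ[ v ∈ Fin r ] (a ≢ b × merge v a ≡ merge v b)
merge-joins _ zero (inj₁ (_ , b≢0)) = ⊥-elim (b≢0 refl)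
merge-joins _ (suc v) (inj₁ (refl , _)) = v , (λ ()) , refl
merge-joins zero _ (inj₂ (_ , a≢0)) = ⊥-elim (a≢0 refl)
merge-joins (suc v) _ (inj₂ (refl , _)) = v , (λ ()) , refl

module Crossing {n m : ℕ} (G : Graph n m) where

  crossing internal : ∀ {r} → Subset m → (Fin n → Fin r) → Fin m → Bool
  crossing S p e = lookup S e ∧ not ⌊ p (tail G e) ≟ p (head G e) ⌋
  internal S p e = lookup S e ∧ ⌊ p (tail G e) ≟ p (head G e) ⌋

  crossCount : ∀ {r} → Subset m → (Fin n → Fin r) → ℕ
  crossCount S p = count (crossing S p)

  crossCount-mono : ∀ {r} {S S′ : Subset m} → S ⊆ S′ → (p : Fin n → Fin r) →
    crossCount S p ℕ.≤ crossCount S′ p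
  crossCount-mono {S = S} {S′} S⊆S′ p = count-mono λ e h →
    let (eS , crosses) = ∧-true⁻ h
    in cong₂ _∧_ ([]=⇒lookup (S⊆S′ (lookup⇒[]= e S eS))) crosses

  ∣S∣-split : ∀ {r} (S : Subset m) (p : Fin n → Fin r) → ∣ S ∣ ≡ crossCount S p + count (internal S p)
  ∣S∣-split S p = trans (∣p∣≡count S)
    (trans (sum-cong-≗ {m} (λ e → split (lookup S e) ⌊ p (tail G e) ≟ p (head G e) ⌋)) (∑-distrib-+ {m} _ _))
    where
    split : ∀ s c → ⟦ s ⟧ ≡ ⟦ s ∧ not c ⟧ + ⟦ s ∧ c ⟧
    split false _ = refl
    split true false = refl
    split true true = refl

  sum-inducedEdges : ∀ {r} (S : Subset m) (p : Fin n → Fin r) →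
    ∑[ j < r ] inducedEdges G S (part p j) ≡ count (internal S p)
  sum-inducedEdges {r} S p = begin
    ∑[ j < r ] inducedEdges G S (part p j)    ≡⟨ sum-cong-≗ {r} (λ j → trans (∣tabulate∣≡count {m} _) (sum-cong-≗ {m} (in-part j))) ⟩
    ∑[ j < r ] ∑[ e < m ] ⟦ inside j e ⟧      ≡⟨ ∑-comm (λ j e → ⟦ inside j e ⟧) ⟩
    ∑[ e < m ] ∑[ j < r ] ⟦ inside j e ⟧      ≡⟨ sum-cong-≗ {m} (λ e → trans (sum-cong-≗ {r} (rotate e)) (sum-pick (p (head G e)) _)) ⟩
    count (internal S p)                      ∎
    where
    open ≡-Reasoning
    inside : Fin r → Fin m → Bool
    inside j e = lookup S e ∧ (⌊ p (tail G e) ≟ j ⌋ ∧ ⌊ p (head G e) ≟ j ⌋)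
    in-part : ∀ j e → ⟦ lookup S e ∧ (lookup (part p j) (tail G e) ∧ lookup (part p j) (head G e)) ⟧
                      ≡ ⟦ inside j e ⟧
    in-part j e = cong₂ (λ a b → ⟦ lookup S e ∧ (a ∧ b) ⟧)
      (lookup∘tabulate _ (tail G e)) (lookup∘tabulate _ (head G e))
    rotate : ∀ e j → ⟦ inside j e ⟧
                     ≡ ⟦ ⌊ p (head G e) ≟ j ⌋ ∧ (lookup S e ∧ ⌊ p (tail G e) ≟ j ⌋) ⟧
    rotate e j = cong ⟦_⟧ (trans (sym (∧-assoc (lookup S e) _ _)) (∧-comm _ ⌊ p (head G e) ≟ j ⌋))

  -- G has no loops, so a one-vertex set spans no edges.
  singleton-spans-nothing : (S : Subset m) (X : Subset n) → ∣ X ∣ ≡ 1 → inducedEdges G S X ≡ 0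
  singleton-spans-nothing S X size = trans (∣tabulate∣≡count {m} _) (count-none no-edge)
    where
    no-edge : ∀ e → lookup S e ∧ (lookup X (tail G e) ∧ lookup X (head G e)) ≢ true
    no-edge e h =
      let (tail∈X , head∈X) = ∧-true⁻ (proj₂ (∧-true⁻ {lookup S e} h))
          two = count-two (tail G e) (head G e) (loopless G e) tail∈X head∈X
      in ℕP.<-irrefl refl (subst (2 ℕ.≤_) (trans (sym (∣p∣≡count X)) size) two)

  sparse-set-bound : ∀ S → Sparse G S → (X : Subset n) → 1 ℕ.≤ ∣ X ∣ →
    inducedEdges G S X + 3 ℕ.≤ 2 ℕ.* ∣ X ∣ + ⟦ ⌊ ∣ X ∣ ℕ.≟ 1 ⌋ ⟧
  sparse-set-bound S sparse X nonempty with ∣ X ∣ in size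
  ... | 1 rewrite singleton-spans-nothing S X size = ≤-refl
  ... | suc (suc s) =
    ≤-trans (subst (λ x → inducedEdges G S X + 3 ℕ.≤ 2 ℕ.* x) size
              (sparse X (subst (2 ℕ.≤_) (sym size) (s≤s (s≤s z≤n)))))
            (m≤m+n _ 0)

  minimallyRigid-bound : ∀ {r} (M : Subset m) → MinimallyRigid G M → (p : Fin n → Fin r) →
    Surjective p → r ℕ.* 3 ℕ.≤ crossCount M p + (3 + trivialParts p)
  minimallyRigid-bound {r} M (sparse , size) p surj = ℕP.+-cancelˡ-≤ I _ _ (begin
    I + r ℕ.* 3                                           ≡⟨ cong₂ _+_ (sum-inducedEdges M p) (sum-const {r} 3) ⟨
    ∑[ j < r ] inducedEdges G M (part p j) + ∑[ j < r ] 3 ≡⟨ ∑-distrib-+ {r} _ _ ⟨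
    ∑[ j < r ] (inducedEdges G M (part p j) + 3)          ≤⟨ sum-mono {r} (λ j → sparse-set-bound M sparse (part p j) (partSize-pos p surj j)) ⟩
    ∑[ j < r ] (2 ℕ.* partSize p j + trivial j)           ≡⟨ ∑-distrib-+ {r} _ _ ⟩
    ∑[ j < r ] (2 ℕ.* partSize p j) + ∑[ j < r ] trivial j ≡⟨ cong₂ _+_ (*-distribˡ-sum {r} 2 _) (∣tabulate∣≡count {r} _) ⟨
    2 ℕ.* ∑[ j < r ] partSize p j + n₀                    ≡⟨ cong (λ x → 2 ℕ.* x + n₀) (sum-partSize p) ⟩
    2 ℕ.* n + n₀                                          ≡⟨ cong (_+ n₀) (trans (sym size) (cong (_+ 3) (∣S∣-split M p))) ⟩
    C + I + 3 + n₀                                        ≡⟨ solve 3 (λ c i z → c :+ i :+ con 3 :+ z := i :+ (c :+ (con 3 :+ z))) refl C I n₀ ⟩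
    I + (C + (3 + n₀))                                    ∎)
    where
    open ℕP.≤-Reasoning
    open +-*-Solver using (solve; _:+_; _:=_; con)
    I C n₀ : ℕ
    I = count (internal M p)
    C = crossCount M p
    n₀ = trivialParts p
    trivial : Fin r → ℕ
    trivial j = ⟦ ⌊ partSize p j ℕ.≟ 1 ⌋ ⟧

  rigid-bound : ∀ {r} (S : Subset m) → Rigid G S → (p : Fin n → Fin r) →
    Surjective p → r ℕ.* 3 ℕ.≤ crossCount S p + (3 + trivialParts p)
  rigid-bound S (M , M⊆S , minRigid) p surj =
    ≤-trans (minimallyRigid-bound M minRigid p surj) (+-monoˡ-≤ _ (crossCount-mono M⊆S p))

  Leaves : ∀ {r} → (Fin n → Fin r) → Fin r → Fin m → Set
  Leaves q L e = (q (tail G e) ≡ L × q (head G e) ≢ L) ⊎ (q (head G e) ≡ L × q (tail G e) ≢ L)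

  walk-leaves : ∀ {r} {S : Subset m} {x y} (q : Fin n → Fin r) (L : Fin r) →
    Reach G S x y → q x ≡ L → q y ≢ L → Σ[ e ∈ Fin m ] (e ∈ S × Leaves q L e)
  walk-leaves q L here qx qy = ⊥-elim (qy qx)
  walk-leaves q L (fwd e e∈S walk) qx qy with q (head G e) ≟ L
  ... | yes qh = walk-leaves q L walk qh qy
  ... | no qh = e , e∈S , inj₁ (qx , qh)
  walk-leaves q L (bwd e e∈S walk) qx qy with q (tail G e) ≟ L
  ... | yes qt = walk-leaves q L walk qt qy
  ... | no qt = e , e∈S , inj₂ (qx , qt)

  edge-leaving-zero : ∀ {r} {S : Subset m} → Connected G S → (q : Fin n → Fin (suc (suc r))) →
    Surjective q → Σ[ e ∈ Fin m ] (e ∈ S × Leaves q zero e)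
  edge-leaving-zero conn q surj =
    walk-leaves q zero (conn (proj₁ (surj zero)) (proj₁ (surj (suc zero)))) (proj₂ (surj zero))
      (λ q≡0 → 0≢1+n (trans (sym q≡0) (proj₂ (surj (suc zero)))))

  coarsen-⊆ : ∀ {r r′} (S : Subset m) (f : Fin r → Fin r′) (q : Fin n → Fin r) →
    crossing S (f ∘ q) ⊆ᵇ crossing S q
  coarsen-⊆ S f q e = antitone (λ same → ⌊≟⌋-true (cong f (⌊≟⌋-true⁻ same)))
    where
    antitone : ∀ {s a b} → (a ≡ true → b ≡ true) → s ∧ not b ≡ true → s ∧ not a ≡ true
    antitone {true} {false} _ _ = refl
    antitone {true} {true} {true} _ ()
    antitone {true} {true} {false} a⇒b _ with () ← a⇒b refl
    antitone {false} _ ()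

  coarsen-drops : ∀ {r r′} (S : Subset m) (f : Fin r → Fin r′) (q : Fin n → Fin r) e →
    lookup S e ≡ true → q (tail G e) ≢ q (head G e) → f (q (tail G e)) ≡ f (q (head G e)) →
    suc (crossCount S (f ∘ q)) ℕ.≤ crossCount S q
  coarsen-drops S f q e e∈S apart joined = count-strict (coarsen-⊆ S f q) e
    (trans (cong (λ d → lookup S e ∧ not d) (⌊≟⌋-true joined)) (∧-zeroʳ _))
    (cong₂ (λ s d → s ∧ not d) e∈S (⌊≟⌋-false apart))

  connected-step : ∀ {r} {S : Subset m} → Connected G S → (q : Fin n → Fin (suc (suc r))) →
    Surjective q → (∀ (q′ : Fin n → Fin (suc r)) → Surjective q′ → suc r ℕ.≤ suc (crossCount S q′)) →
    suc (suc r) ℕ.≤ suc (crossCount S q)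
  connected-step {S = S} conn q surj bound
    with e , e∈S , leaves ← edge-leaving-zero conn q surj
    with v , apart , joined ← merge-joins (q (tail G e)) (q (head G e)) leaves
    = s≤s (≤-trans (bound (merge v ∘ q) (merge-surjective v q surj))
                   (coarsen-drops S (merge v) q e ([]=⇒lookup e∈S) apart joined))

  connected-bound : ∀ {r} {S : Subset m} → Connected G S → (q : Fin n → Fin r) →
    Surjective q → r ℕ.≤ suc (crossCount S q)
  connected-bound {zero} conn q surj = z≤n
  connected-bound {suc zero} conn q surj = s≤s z≤n
  connected-bound {suc (suc r)} conn q surj = connected-step conn q surj (connected-bound conn)

  disjoint-bound : ∀ {k l r} (R : Fin k → Subset m) (T : Fin l → Subset m) (p : Fin n → Fin r) →
    (∀ i i′ → i ≢ i′ → Empty (R i ∩ R i′)) → (∀ j j′ → j ≢ j′ → Empty (T j ∩ T j′)) →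
    (∀ i j → Empty (R i ∩ T j)) →
    ∑[ i < k ] crossCount (R i) p + ∑[ j < l ] crossCount (T j) p ℕ.≤ crossEdges G p
  disjoint-bound {k} {l} R T p disjR disjT disjRT = begin
    ∑[ i < k ] crossCount (R i) p + ∑[ j < l ] crossCount (T j) p
      ≡⟨ cong₂ _+_ (∑-comm (λ i e → ⟦ crossing (R i) p e ⟧)) (∑-comm (λ j e → ⟦ crossing (T j) p e ⟧)) ⟩
    ∑[ e < m ] count (λ i → crossing (R i) p e) + ∑[ e < m ] count (λ j → crossing (T j) p e)
      ≡⟨ ∑-distrib-+ {m} _ _ ⟨
    ∑[ e < m ] (count (λ i → crossing (R i) p e) + count (λ j → crossing (T j) p e))
      ≤⟨ sum-mono at-most-once ⟩
    ∑[ e < m ] ⟦ crosses e ⟧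
      ≡⟨ ∣tabulate∣≡count crosses ⟨
    crossEdges G p ∎
    where
    open ℕP.≤-Reasoning
    crosses : Fin m → Bool
    crosses e = not ⌊ p (tail G e) ≟ p (head G e) ⌋
    at-most-once : ∀ e → count (λ i → crossing (R i) p e) + count (λ j → crossing (T j) p e) ℕ.≤ ⟦ crosses e ⟧
    at-most-once e = begin
      count (λ i → crossing (R i) p e) + count (λ j → crossing (T j) p e)
        ≡⟨ cong₂ _+_ (count-∧ (λ i → lookup (R i) e) (crosses e)) (count-∧ (λ j → lookup (T j) e) (crosses e)) ⟩
      ⟦ crosses e ⟧ ℕ.* count (λ i → lookup (R i) e) + ⟦ crosses e ⟧ ℕ.* count (λ j → lookup (T j) e)
        ≡⟨ ℕP.*-distribˡ-+ ⟦ crosses e ⟧ _ _ ⟨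
      ⟦ crosses e ⟧ ℕ.* (count (λ i → lookup (R i) e) + count (λ j → lookup (T j) e))
        ≤⟨ ℕP.*-monoʳ-≤ ⟦ crosses e ⟧ (exclusive-pair (disjoint⇒exclusive R disjR e) (disjoint⇒exclusive T disjT e)
             (λ i j h h′ → disjRT i j (e , x∈p∩q⁺ (lookup⇒[]= e (R i) h , lookup⇒[]= e (T j) h′)))) ⟩
      ⟦ crosses e ⟧ ℕ.* 1
        ≡⟨ ℕP.*-identityʳ _ ⟩
      ⟦ crosses e ⟧ ∎

ℕ-bound⇒ℤ-bound : ∀ {A B C} → A ℕ.≤ C + B → + A - + B ≤ + C
ℕ-bound⇒ℤ-bound {A} {B} {C} A≤C+B = begin
  + A - + B        ≡⟨ ℤP.m-n≡m⊖n A B ⟩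
  A ℤ.⊖ B          ≤⟨ ℤP.⊖-monoˡ-≤ B A≤C+B ⟩
  (C + B) ℤ.⊖ B    ≡⟨ ℤP.⊖-≥ (m≤n+m B C) ⟩
  + (C + B ℕ.∸ B)  ≡⟨ cong +_ (ℕP.m+n∸n≡m C B) ⟩
  + C              ∎
  where open ℤP.≤-Reasoning

integer-form : ∀ a k r n₀ C → a ℕ.* r ℕ.≤ C + (k ℕ.* n₀ + a) →
  (+ a) * (+ r - + 1) - (+ k) * (+ n₀) ≤ + C
integer-form a k r n₀ C bound = begin
  (+ a) * (+ r - + 1) - (+ k) * (+ n₀)  ≡⟨ solve 4 (λ a r k z → a :* (r :- con (+ 1)) :- k :* z
                                               := a :* r :- (k :* z :+ a)) refl (+ a) (+ r) (+ k) (+ n₀) ⟩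
  (+ a) * (+ r) - ((+ k) * (+ n₀) ℤ.+ + a) ≡⟨ cong₂ _-_ (ℤP.pos-* a r) (cong (ℤ._+ + a) (ℤP.pos-* k n₀)) ⟨
  + (a ℕ.* r) - (+ (k ℕ.* n₀) ℤ.+ + a)  ≡⟨ cong (_-_ (+ (a ℕ.* r))) (ℤP.pos-+ (k ℕ.* n₀) a) ⟨
  + (a ℕ.* r) - + (k ℕ.* n₀ + a)        ≤⟨ ℕ-bound⇒ℤ-bound bound ⟩
  + C                                   ∎
  where
  open ℤP.≤-Reasoning
  open ℤSolver.+-*-Solver using (solve; _:+_; _:-_; _:*_; _:=_; con)

mainTheorem5 : (k l : ℕ) {n m : ℕ} (G : Graph n m)
    (R : Fin k → Subset m) (T : Fin l → Subset m)
    → (∀ i → Rigid G (R i))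
    → (∀ j → SpanningTree G (T j))
    → (∀ i i′ → i ≢ i′ → Empty (R i ∩ R i′))
    → (∀ j j′ → j ≢ j′ → Empty (T j ∩ T j′))
    → (∀ i j → Empty (R i ∩ T j))
    → {r : ℕ} (p : Fin n → Fin r) → Surjective p
    → (+ (3 Data.Nat.* k Data.Nat.+ l)) * (+ r - + 1) - (+ k) * (+ trivialParts p) ≤ + crossEdges G p
mainTheorem5 k l G R T rigid trees disjR disjT disjRT {r} p surj =
  integer-form (3 ℕ.* k + l) k r n₀ (crossEdges G p) (begin
    (3 ℕ.* k + l) ℕ.* r                          ≡⟨ solve 3 (λ k l r → (con 3 :* k :+ l) :* r
                                                      := k :* (r :* con 3) :+ l :* r) refl k l r ⟩
    k ℕ.* (r ℕ.* 3) + l ℕ.* r                    ≤⟨ +-mono-≤ (sum-bound _ (λ i → rigid-bound (R i) (rigid i) p surj))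
                                                               (sum-bound _ (λ j → tree-bound j)) ⟩
    (ΣR + k ℕ.* (3 + n₀)) + (ΣT + l ℕ.* 1)       ≡⟨ solve 5 (λ x y k l z → (x :+ k :* (con 3 :+ z)) :+ (y :+ l :* con 1)
                                                      := (x :+ y) :+ (k :* z :+ (con 3 :* k :+ l))) refl ΣR ΣT k l n₀ ⟩
    (ΣR + ΣT) + (k ℕ.* n₀ + (3 ℕ.* k + l))       ≤⟨ +-monoˡ-≤ _ (disjoint-bound R T p disjR disjT disjRT) ⟩
    crossEdges G p + (k ℕ.* n₀ + (3 ℕ.* k + l))  ∎)
  where
  open Crossing G
  open ℕP.≤-Reasoning
  open +-*-Solver using (solve; _:+_; _:*_; _:=_; con)
  n₀ ΣR ΣT : ℕ
  n₀ = trivialParts p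
  ΣR = ∑[ i < k ] crossCount (R i) p
  ΣT = ∑[ j < l ] crossCount (T j) p
  tree-bound : ∀ j → r ℕ.≤ crossCount (T j) p + 1
  tree-bound j = subst (r ℕ.≤_) (ℕP.+-comm 1 _) (connected-bound (proj₁ (trees j)) p surj)
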